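{- Let $n\geq1$, let $A\in\mathbb{M}_n(\mathbb{R})$ be a connected unidiagonal triangle-integral matrix, and let $s\in\{0,1,2,3\}$ be an arbitrary fixed strategy. Then: (a) the pessimistic (worst-case) complexity of Algorithm PosDefTestByInflations$(A,s)$ is $O(n^4)$; (b) the pessimistic (worst-case) complexity of Algorithm PosDefTestByRootInflations$(A,s)$ is $O(n^3)$. Here the algorithms are: PosDefTestByInflations$(A,s)$: set $\Delta:=\Delta(A)$; set $D:=$ InflationsAtPairPos$(\Delta,s)$; return true if $D$ is a Dynkin graph, false otherwise. PosDefTestByRootInflations$(A,s)$: set $\Delta:=\Delta(A)$; set $\hat\Delta:=$ InflationsToPosSincereRoot$(\Delta)$; set $D:=$ InflationsAtPairPoss$(\hat\Delta,s)$; return true if $D$ is a Dynkin graph, false otherwise.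
   Context: For $A=[a_{ij}]\in\mathbb{M}_n(\mathbb{R})$, $\nabla(A)$ is the upper triangular matrix with entries $a_{ij}+a_{ji}$ ($i<j$), $a_{ii}$ on the diagonal and $0$ below. $A$ is unidiagonal if its diagonal entries are all $1$ and triangle-integral if $\nabla(A)$ is integral. A loop-free bigraph on $\{1,\dots,n\}$ (loopless multigraph with solid and dotted edges, two vertices joined by edges of only one kind) is encoded by integers $d_{ij}=d_{ji}$: $-m$ for $m$ solid edges, $+m$ for $m$ dotted edges; its Gram matrix is upper triangular with $1$'s on the diagonal and $d_{ij}$ at $(i,j)$, $i<j$. $\Delta(A)$ is the bigraph with $d_{ij}$ equal to the $(i,j)$ entry of $\nabla(A)$ for $i<j$; $A$ is connected if the underlying graph of $\Delta(A)$ is connected. Inflation at vertex $a$: $d'_{ac}=-d_{ac}$ ($c\ne a$). Inflation at pair $(a,b)$, defined iff $d_{ab}>0$: $d'_{ab}=-d_{ab}$, $d'_{bc}=d_{bc}-d_{ac}d_{ab}$ ($c\neq a,b$), others unchanged. A Dynkin graph is a bigraph with all $d_{ij}\in\{0,-1\}$ whose underlying simple graph is one of the Dynkin diagrams $\mathbb{A}_n$ ($n\ge1$), $\mathbb{D}_n$ ($n\ge4$), $\mathbb{E}_6,\mathbb{E}_7,\mathbb{E}_8$. InflationsAtPair$(\Delta,s)$: while $\Delta$ has a dotted edge, select a dotted edge $a\cdots b$ according to strategy $s$ and set $\Delta:=\mathrm{infl}_{a,b}\Delta$; finally return $D:=\Delta$. Strategies: $s=0$: the dotted edge $(a,b)$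 smallest in lexicographic order among dotted edges; $s=1$: the lexicographically greatest; $s=2$: randomly the first or the last; $s=3$: a random dotted edge. InflationsAtPairPos (resp. InflationsAtPairPoss) works as InflationsAtPair but stops the loop after $\mu(n)$ (resp. $\mu'(n)$) inflations, where $\mu(n)=\frac12(n^2-n)$ for $n\in\{1,2,3\}$, $\mu(6)=30$, $\mu(7)=56$, $\mu(8)=112$, $\mu(n)=n^2-2n$ otherwise; $\mu'(n)=0$ for $n\in\{1,2,3\}$, $\mu'(6)=5$, $\mu'(7)=10$, $\mu'(8)=21$, $\mu'(n)=n-3$ otherwise. InflationsToPosSincereRoot$(\Delta)$: set $S:=\{1\}$; while $|S|<n$: choose $(a,b)\in S\times(\{1,\dots,n\}\setminus S)$ with $d_{ab}\neq0$; if $d_{ab}<0$ set $\Delta:=\mathrm{infl}_b\Delta$; set $\Delta:=\mathrm{infl}_{b,a}\Delta$; set $S:=S\cup\{b\}$; return $\Delta$. Complexity is counted as the number of arithmetic operations performed on the coefficients of the Gram matrix of the current bigraph. -}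

module Defs where

open import Level using (Level)
open import Data.Nat as ℕ using (ℕ; zero; suc; _∸_)
open import Data.Integer as ℤ using (ℤ; +_; -[1+_]; 0ℤ)
open import Data.Fin using (Fin; toℕ; _≟_)
import Data.Fin as Fin
open import Data.Bool using (Bool; true; false; if_then_else_; _∧_; _∨_; not)
open import Data.List using (List; []; _∷_; [_]; _++_; concatMap; filter; allFin)
open import Data.List.Membership.Propositional using (_∈_)
open import Data.Product using (_×_; _,_; proj₁; proj₂)
open import Relation.Nullary using (¬_; does)
open import Relation.Binary.PropositionalEquality using (_≡_)
open import Algebra.Bundles using (CommutativeRing)

module _ {c ℓ : Level} (R : CommutativeRing c ℓ) where
  open CommutativeRing R

  natCast : ℕ → Carrier
  natCast zero = 0#
  natCast (suc k) = 1# + natCast k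

  intCast : ℤ → Carrier
  intCast (+ k) = natCast k
  intCast -[1+ k ] = - natCast (suc k)

  Unidiagonal : {n : ℕ} → (Fin n → Fin n → Carrier) → Set ℓ
  Unidiagonal {n} A = (i : Fin n) → A i i ≈ 1#

  -- d is the bigraph Δ(A): it is symmetric and, off the diagonal,
  -- d i j is the integer a_ij + a_ji (the (min,max) entry of ∇(A)).
  -- A admits such a d iff A is triangle-integral.
  IsDelta : {n : ℕ} → (Fin n → Fin n → Carrier) → (Fin n → Fin n → ℤ) → Set ℓ
  IsDelta {n} A d =
    ((i j : Fin n) → d i j ≡ d j i) ×
    ((i j : Fin n) → ¬ (i ≡ j) → (A i j + A j i) ≈ intCast (d i j))

-- Bigraphs on Fin n: symmetric integer matrices d (d i j = d_ij for i ≠ j;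
-- diagonal entries are never read).

Bigraph : ℕ → Set
Bigraph n = Fin n → Fin n → ℤ

data Reach {n : ℕ} (d : Bigraph n) : Fin n → Fin n → Set where
  here : ∀ {i} → Reach d i i
  step : ∀ {i k j} → ¬ (i ≡ k) → ¬ (d i k ≡ 0ℤ) → Reach d k j → Reach d i j

Connected : {n : ℕ} → Bigraph n → Set
Connected {n} d = (i j : Fin n) → Reach d i j

_==_ : {n : ℕ} → Fin n → Fin n → Bool
i == j = does (i ≟ j)

inflV : {n : ℕ} → Fin n → Bigraph n → Bigraph n
inflV a d i j =
  if ((i == a) ∧ not (j == a)) ∨ ((j == a) ∧ not (i == a))
  then ℤ.- d i j else d i j

inflP : {n : ℕ} → Fin n → Fin n → Bigraph n → Bigraph n
inflP a b d i j =
  if ((i == a) ∧ (j == b)) ∨ ((i == b) ∧ (j == a)) then ℤ.- d i j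
  else if (i == b) ∧ not (j == a) ∧ not (j == b)
       then d b j ℤ.- d a j ℤ.* d a b
  else if (j == b) ∧ not (i == a) ∧ not (i == b)
       then d i b ℤ.- d a i ℤ.* d a b
  else d i j

allPairs : (n : ℕ) → List (Fin n × Fin n)
allPairs n = concatMap (λ i → concatMap (λ j →
  if toℕ i ℕ.<ᵇ toℕ j then [ (i , j) ] else []) (allFin n)) (allFin n)

dotted : {n : ℕ} → Bigraph n → List (Fin n × Fin n)
dotted {n} d = filter (λ p → ℤ.+ 0 ℤ.<? d (proj₁ p) (proj₂ p)) (allPairs n)

data Select {n : ℕ} (d : Bigraph n) : Fin 4 → Fin n × Fin n → Set where
  s0 : ∀ {e rest} → dotted d ≡ e ∷ rest → Select d Fin.zero e
  s1 : ∀ {e rest} → dotted d ≡ rest ++ [ e ] → Select d (Fin.suc Fin.zero) e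
  s2first : ∀ {e rest} → dotted d ≡ e ∷ rest → Select d (Fin.suc (Fin.suc Fin.zero)) e
  s2last : ∀ {e rest} → dotted d ≡ rest ++ [ e ] → Select d (Fin.suc (Fin.suc Fin.zero)) e
  s3 : ∀ {e} → e ∈ dotted d → Select d (Fin.suc (Fin.suc (Fin.suc Fin.zero))) e

-- Cost model (number of operations on Gram coefficients):
--   * computing Δ(A) from A                : n²
--   * one search for a dotted edge / pair  : n²  (scan of the Gram matrix)
--   * one inflation at a vertex            : n
--   * one inflation at a pair              : 3n  (≥ 2(n-2)+1 operations)
--   * deciding whether D is Dynkin         : n²

-- InflationsAtPair with a bound k on the number of inflations.
-- PairLoop s k Δ D cost : a (possibly nondeterministic) run ending in D.
data PairLoop {n : ℕ} (s : Fin 4) : ℕ → Bigraph n → Bigraph n → ℕ → Set where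
  stop-bound : ∀ {d} → PairLoop s zero d d 0
  stop-none  : ∀ {k d} → dotted d ≡ [] → PairLoop s (suc k) d d (n ℕ.* n)
  infl       : ∀ {k d D c a b} → Select d s (a , b) →
               PairLoop s k (inflP a b d) D c →
               PairLoop s (suc k) d D (n ℕ.* n ℕ.+ 3 ℕ.* n ℕ.+ c)

μ : ℕ → ℕ
μ 0 = 0
μ 1 = 0
μ 2 = 1
μ 3 = 3
μ 6 = 30
μ 7 = 56
μ 8 = 112
μ n = n ℕ.* n ∸ 2 ℕ.* n

μ' : ℕ → ℕ
μ' 0 = 0
μ' 1 = 0
μ' 2 = 0
μ' 3 = 0
μ' 6 = 5
μ' 7 = 10
μ' 8 = 21
μ' n = n ∸ 3

-- InflationsToPosSincereRoot; S is the current set of vertices (as a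
-- characteristic function).
data RootLoop {n : ℕ} : (Fin n → Bool) → Bigraph n → Bigraph n → ℕ → Set where
  done : ∀ {S d} → ((i : Fin n) → S i ≡ true) → RootLoop S d d 0
  stepNeg : ∀ {S d D c a b} → S a ≡ true → S b ≡ false →
            d a b ℤ.< 0ℤ →
            RootLoop (λ i → S i ∨ (i == b)) (inflP b a (inflV b d)) D c →
            RootLoop S d D (n ℕ.* n ℕ.+ n ℕ.+ 3 ℕ.* n ℕ.+ c)
  stepPos : ∀ {S d D c a b} → S a ≡ true → S b ≡ false →
            0ℤ ℤ.< d a b →
            RootLoop (λ i → S i ∨ (i == b)) (inflP b a d) D c →
            RootLoop S d D (n ℕ.* n ℕ.+ 3 ℕ.* n ℕ.+ c)

initS : {n : ℕ} → Fin (suc n) → Bool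
initS i = i == Fin.zero

-- The two test algorithms, started from Δ = Δ(A); D is the final bigraph
-- (whose Dynkin-ness is the returned Boolean) and cost the total cost.

data RunInfl {n : ℕ} (s : Fin 4) (Δ : Bigraph n) : Bigraph n → ℕ → Set where
  run : ∀ {D c} → PairLoop s (μ n) Δ D c →
        RunInfl s Δ D (n ℕ.* n ℕ.+ c ℕ.+ n ℕ.* n)

data RunRoot {n : ℕ} (s : Fin 4) (Δ : Bigraph (suc n)) : Bigraph (suc n) → ℕ → Set where
  run : ∀ {Δ̂ D c₁ c₂} → RootLoop initS Δ Δ̂ c₁ → PairLoop s (μ' (suc n)) Δ̂ D c₂ →
        RunRoot s Δ D (suc n ℕ.* suc n ℕ.+ c₁ ℕ.+ c₂ ℕ.+ suc n ℕ.* suc n)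

-- Every run performs a bounded number of inflations, each costing O(n²) (a scan
-- of the Gram matrix plus O(n) coefficient updates): at most μ(n) + 1 = O(n²) of
-- them in the first test and at most n + μ′(n) + 1 = O(n) in the second.  What
-- needs an argument is that InflationsToPosSincereRoot never gets stuck: the
-- inflation at a pair (p, q) with d_pq ≠ 0 keeps the bigraph symmetric and
-- connected, since an edge q–k that it cancels is replaced by the path q–p–k.
-- Hence while some vertex lies outside S, connectedness provides an edge leaving
-- S, and each step adds a vertex to S.
module Submission where

open import Defs
open import Level using (Level)
open import Function using (_∘_)
open import Data.Nat using (ℕ; zero; suc; _+_; _*_; _^_; _∸_; _≤_; _<_; z≤n; s≤s; NonZero)
open import Data.Nat.Properties
  using (≤-refl; ≤-reflexive; ≤-trans; <-≤-trans; ≤-pred; n≮0; m≤m+n; m≤n+m; m∸n≤m; ∸-monoʳ-<;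
         ≤ᵇ⇒≤; module ≤-Reasoning; +-mono-≤; +-monoˡ-≤; *-mono-≤; *-monoˡ-≤; *-monoʳ-≤;
         *-identityˡ; *-identityʳ; *-distribʳ-+;
         [m*n]*[o*p]≡[m*o]*[n*p]; ^-distribˡ-+-*; ^-monoʳ-≤)
open import Data.Integer as ℤ using (ℤ; 0ℤ)
open import Data.Integer.Properties using (neg-injective; +-identityʳ; <-cmp)
open import Data.Fin using (Fin; zero; suc; _≟_)
open import Data.Fin.Properties using (all?; ¬∀⟶∃¬)
open import Data.Fin.Subset using (_∈_; _⊂_; ∣_∣)
open import Data.Fin.Subset.Properties using (p⊂q⇒∣p∣<∣q∣; ∣p∣≤n)
open import Data.Bool using (Bool; true; false; if_then_else_; _∧_; _∨_; not)
import Data.Bool as Bool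
open import Data.Bool.Properties using (∨-comm; ∨-zeroʳ; ¬-not; not-¬)
open import Data.List using (List; []; _∷_; [_]; _++_)
open import Data.List.Membership.Propositional using () renaming (_∈_ to _∈ˡ_)
open import Data.List.Relation.Unary.Any using (here)
open import Data.Vec using (tabulate)
open import Data.Vec.Properties using (lookup∘tabulate; []=⇒lookup; lookup⇒[]=)
open import Data.Product using (_×_; _,_; proj₁; ∃; ∃-syntax; ∃₂)
open import Data.Empty using (⊥-elim)
open import Data.Unit using (tt)
open import Relation.Nullary using (yes; no)
open import Relation.Nullary.Decidable using (dec-true; dec-false)
open import Relation.Binary using (tri<; tri≈; tri>)
open import Relation.Binary.PropositionalEquality
  using (_≡_; _≢_; refl; sym; trans; cong; subst; module ≡-Reasoning)
open import Algebra.Bundles using (CommutativeRing)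

private
  variable
    n : ℕ
    d : Bigraph n
    i j : Fin n

Symmetric : Bigraph n → Set
Symmetric d = ∀ i j → d i j ≡ d j i

==-refl : (i : Fin n) → (i == i) ≡ true
==-refl i = dec-true (i ≟ i) refl

≢⇒==-false : i ≢ j → (i == j) ≡ false
≢⇒==-false {i = i} {j} i≢j = dec-false (i ≟ j) i≢j

neg-≢0 : {x : ℤ} → x ≢ 0ℤ → ℤ.- x ≢ 0ℤ
neg-≢0 x≢0 = x≢0 ∘ neg-injective {j = 0ℤ}

Reach-trans : ∀ {k} → Reach d i j → Reach d j k → Reach d i k
Reach-trans here          r′ = r′
Reach-trans (step i≢k ik≢0 r) r′ = step i≢k ik≢0 (Reach-trans r r′)

Reach-sym : Symmetric d → Reach d i j → Reach d j i
Reach-sym sym-d here = here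
Reach-sym sym-d (step {i} {k} i≢k ik≢0 r) =
  Reach-trans (Reach-sym sym-d r) (step (i≢k ∘ sym) (ik≢0 ∘ trans (sym-d i k)) here)

edges-reachable⇒connected : {d d′ : Bigraph n} →
                            (∀ {i k} → i ≢ k → d i k ≢ 0ℤ → Reach d′ i k) →
                            Connected d → Connected d′
edges-reachable⇒connected {d = d} {d′} edge conn i j = go (conn i j)
  where
  go : ∀ {i j} → Reach d i j → Reach d′ i j
  go here              = here
  go (step i≢k ik≢0 r) = Reach-trans (edge i≢k ik≢0) (go r)

inflV-≢0 : (b : Fin n) (d : Bigraph n) → d i j ≢ 0ℤ → inflV b d i j ≢ 0ℤ
inflV-≢0 {i = i} {j} b d = if-neg-≢0 (((i == b) ∧ not (j == b)) ∨ ((j == b) ∧ not (i == b)))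
  where
  if-neg-≢0 : ∀ c → d i j ≢ 0ℤ → (if c then ℤ.- d i j else d i j) ≢ 0ℤ
  if-neg-≢0 true  = neg-≢0
  if-neg-≢0 false ij≢0 = ij≢0

inflV-sym : (b : Fin n) → Symmetric d → Symmetric (inflV b d)
inflV-sym b sym-d i j
  rewrite sym-d i j | ∨-comm ((i == b) ∧ not (j == b)) ((j == b) ∧ not (i == b)) = refl

inflV-connected : (b : Fin n) (d : Bigraph n) → Connected d → Connected (inflV b d)
inflV-connected b d = edges-reachable⇒connected (λ i≢k ik≢0 → step i≢k (inflV-≢0 b d ik≢0) here)

module _ {p q : Fin n} (p≢q : p ≢ q) (d : Bigraph n) where

  private
    d′ : Bigraph n
    d′ = inflP p q d

  inflP-pq : d′ p q ≡ ℤ.- d p q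
  inflP-pq rewrite ==-refl p | ==-refl q = refl

  inflP-qp : d′ q p ≡ ℤ.- d q p
  inflP-qp rewrite ==-refl p | ==-refl q | ≢⇒==-false (p≢q ∘ sym) = refl

  inflP-row : ∀ {k} → k ≢ p → k ≢ q → d′ q k ≡ d q k ℤ.- d p k ℤ.* d p q
  inflP-row k≢p k≢q rewrite ==-refl q | ≢⇒==-false k≢p | ≢⇒==-false k≢q
                          | ≢⇒==-false (p≢q ∘ sym) = refl

  inflP-col : ∀ {k} → k ≢ p → k ≢ q → d′ k q ≡ d k q ℤ.- d p k ℤ.* d p q
  inflP-col k≢p k≢q rewrite ==-refl q | ≢⇒==-false k≢p | ≢⇒==-false k≢q = refl

  inflP-off : ∀ {i k} → i ≢ q → k ≢ q → d′ i k ≡ d i k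
  inflP-off {i} {k} i≢q k≢q rewrite ≢⇒==-false i≢q | ≢⇒==-false k≢q with i == p
  ... | true  = refl
  ... | false = refl

  inflP-row≡col : Symmetric d → ∀ {k} → k ≢ q → d′ q k ≡ d′ k q
  inflP-row≡col sym-d {k} k≢q with p ≟ k
  ... | yes refl = trans inflP-qp (trans (cong ℤ.-_ (sym-d q p)) (sym inflP-pq))
  ... | no p≢k   = begin
    d′ q k                      ≡⟨ inflP-row (p≢k ∘ sym) k≢q ⟩
    d q k ℤ.- d p k ℤ.* d p q   ≡⟨ cong (ℤ._- d p k ℤ.* d p q) (sym-d q k) ⟩
    d k q ℤ.- d p k ℤ.* d p q   ≡⟨ inflP-col (p≢k ∘ sym) k≢q ⟨
    d′ k q                      ∎
    where open ≡-Reasoning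

  inflP-sym : Symmetric d → Symmetric d′
  inflP-sym sym-d i j with q ≟ i | q ≟ j
  ... | yes refl | yes refl = refl
  ... | yes refl | no q≢j   = inflP-row≡col sym-d (q≢j ∘ sym)
  ... | no q≢i   | yes refl = sym (inflP-row≡col sym-d (q≢i ∘ sym))
  ... | no q≢i   | no q≢j   = trans (inflP-off (q≢i ∘ sym) (q≢j ∘ sym))
                                (trans (sym-d i j) (sym (inflP-off (q≢j ∘ sym) (q≢i ∘ sym))))

  -- If the update cancels the edge q–k, then d p k ≠ 0, so q–p–k survives.
  inflP-row-reachable : Symmetric d → d p q ≢ 0ℤ →
                        ∀ {k} → q ≢ k → d q k ≢ 0ℤ → Reach d′ q k
  inflP-row-reachable sym-d pq≢0 {k} q≢k qk≢0 with p ≟ k | d′ q k ℤ.≟ 0ℤ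
  ... | yes refl | _        = step q≢k (neg-≢0 qk≢0 ∘ trans (sym inflP-qp)) here
  ... | no _     | no qk′≢0 = step q≢k qk′≢0 here
  ... | no p≢k   | yes qk′≡0 =
    step (p≢q ∘ sym) (neg-≢0 (pq≢0 ∘ trans (sym-d p q)) ∘ trans (sym inflP-qp))
      (step p≢k (pk≢0 ∘ trans (sym (inflP-off (p≢q) (q≢k ∘ sym)))) here)
    where
    open ≡-Reasoning
    pk≢0 : d p k ≢ 0ℤ
    pk≢0 pk≡0 = qk≢0 (begin
      d q k                         ≡⟨ +-identityʳ (d q k) ⟨
      d q k ℤ.- 0ℤ ℤ.* d p q        ≡⟨ cong (λ x → d q k ℤ.- x ℤ.* d p q) pk≡0 ⟨
      d q k ℤ.- d p k ℤ.* d p q     ≡⟨ inflP-row (p≢k ∘ sym) (q≢k ∘ sym) ⟨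
      d′ q k                        ≡⟨ qk′≡0 ⟩
      0ℤ                            ∎)

  inflP-connected : Symmetric d → d p q ≢ 0ℤ → Connected d → Connected d′
  inflP-connected sym-d pq≢0 = edges-reachable⇒connected edge
    where
    edge : ∀ {i k} → i ≢ k → d i k ≢ 0ℤ → Reach d′ i k
    edge {i} {k} i≢k ik≢0 with i ≟ q | k ≟ q
    ... | yes refl | _        = inflP-row-reachable sym-d pq≢0 i≢k ik≢0
    ... | no _     | yes refl =
      Reach-sym (inflP-sym sym-d) (inflP-row-reachable sym-d pq≢0 (i≢k ∘ sym) (ik≢0 ∘ trans (sym-d i q)))
    ... | no i≢q   | no k≢q   = step i≢k (ik≢0 ∘ trans (sym (inflP-off i≢q k≢q))) here

∷-∃-∷ʳ : ∀ {A : Set} (x : A) (xs : List A) → ∃₂ λ ys y → x ∷ xs ≡ ys ++ [ y ]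
∷-∃-∷ʳ x []       = [] , x , refl
∷-∃-∷ʳ x (y ∷ ys) with ∷-∃-∷ʳ y ys
... | zs , z , eq = x ∷ zs , z , cong (x ∷_) eq

select : ∀ s {e rest} → dotted d ≡ e ∷ rest → ∃ (Select d s)
select zero                        eq = _ , s0 eq
select (suc zero) {e} {rest}       eq with ∷-∃-∷ʳ e rest
... | _ , _ , eq′ = _ , s1 (trans eq eq′)
select (suc (suc zero))            eq = _ , s2first eq
select (suc (suc (suc zero))) {e}  eq = e , s3 (subst (_ ∈ˡ_) (sym eq) (here refl))

pairLoop-exists : ∀ s k (d : Bigraph n) → ∃₂ (PairLoop s k d)
pairLoop-exists s zero    d = d , 0 , stop-bound
pairLoop-exists s (suc k) d with dotted d in eq
... | []    = d , _ , stop-none eq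
... | _ ∷ _ with select s eq
... | (a , b) , sel with pairLoop-exists s k (inflP a b d)
... | D , c , loop = D , _ , infl sel loop

pairLoop-cost : ∀ {s k} {d D : Bigraph n} {c} → PairLoop s k d D c → c ≤ suc k * (n * n + 3 * n)
pairLoop-cost     stop-bound    = z≤n
pairLoop-cost {n} (stop-none _) = ≤-trans (m≤m+n (n * n) (3 * n)) (m≤m+n _ _)
pairLoop-cost     (infl _ loop) = +-mono-≤ ≤-refl (pairLoop-cost loop)

extend : (Fin n → Bool) → Fin n → Fin n → Bool
extend S b i = S i ∨ (i == b)

unvisited : (Fin n → Bool) → ℕ
unvisited {n} S = n ∸ ∣ tabulate S ∣

unvisited≤n : (S : Fin n → Bool) → unvisited S ≤ n
unvisited≤n S = m∸n≤m _ ∣ tabulate S ∣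

∈-tabulate⁺ : ∀ {S : Fin n → Bool} → S i ≡ true → i ∈ tabulate S
∈-tabulate⁺ {i = i} {S} Si = lookup⇒[]= i (tabulate S) (trans (lookup∘tabulate S i) Si)

∈-tabulate⁻ : ∀ {S : Fin n → Bool} → i ∈ tabulate S → S i ≡ true
∈-tabulate⁻ {i = i} {S} i∈S = trans (sym (lookup∘tabulate S i)) ([]=⇒lookup i∈S)

module _ {S : Fin n → Bool} where

  extend-⊇ : ∀ {b} → S i ≡ true → extend S b i ≡ true
  extend-⊇ Si rewrite Si = refl

  unvisited-extend : ∀ {b} → S b ≡ false → unvisited (extend S b) < unvisited S
  unvisited-extend {b} Sb = ∸-monoʳ-< (p⊂q⇒∣p∣<∣q∣ S⊂S+b) (∣p∣≤n (tabulate (extend S b)))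
    where
    b∈S+b : extend S b b ≡ true
    b∈S+b rewrite ==-refl b = ∨-zeroʳ (S b)
    S⊂S+b : tabulate S ⊂ tabulate (extend S b)
    S⊂S+b = (λ i∈S → ∈-tabulate⁺ (extend-⊇ (∈-tabulate⁻ i∈S))) , b , ∈-tabulate⁺ b∈S+b ,
            not-¬ Sb ∘ ∈-tabulate⁻

  crossing-edge : ∀ {a b} → S a ≡ true → S b ≡ false → Reach d a b →
                  ∃₂ λ a′ b′ → S a′ ≡ true × S b′ ≡ false × d a′ b′ ≢ 0ℤ
  crossing-edge Sa Sb here = ⊥-elim (not-¬ Sb Sa)
  crossing-edge {a = a} Sa Sb (step {k = k} _ ak≢0 r) with S k in Sk
  ... | true  = crossing-edge Sk Sb r
  ... | false = a , k , Sa , Sk , ak≢0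

mutual
  rootLoop-exists : ∀ t {S : Fin n → Bool} {a₀} (d : Bigraph n) → unvisited S ≤ t → S a₀ ≡ true →
                    Symmetric d → Connected d → ∃₂ (RootLoop S d)
  rootLoop-exists t {S} {a₀} d fuel Sa₀ sym-d conn with all? (λ i → S i Bool.≟ true)
  ... | yes all-visited = d , 0 , done all-visited
  ... | no ¬all-visited with ¬∀⟶∃¬ _ _ (λ i → S i Bool.≟ true) ¬all-visited
  ... | b , Sb≢true with crossing-edge Sa₀ (¬-not Sb≢true) (conn a₀ b)
  ... | a , b′ , Sa , Sb′ , ab′≢0 with t | <-cmp (d a b′) 0ℤ
  ... | zero  | _             = ⊥-elim (n≮0 (<-≤-trans (unvisited-extend {S = S} Sb′) fuel))
  ... | suc t | tri≈ _ ab′≡0 _ = ⊥-elim (ab′≢0 ab′≡0)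
  ... | suc t | tri< ab′<0 _ _ =
    let D , _ , loop = rootLoop-step t (inflV b′ d) fuel Sa₀ Sa Sb′
                         (inflV-sym b′ sym-d) (inflV-connected b′ d conn)
                         (inflV-≢0 b′ d (ab′≢0 ∘ trans (sym-d a b′)))
    in D , _ , stepNeg Sa Sb′ ab′<0 loop
  ... | suc t | tri> _ _ ab′>0 =
    let D , _ , loop = rootLoop-step t d fuel Sa₀ Sa Sb′ sym-d conn (ab′≢0 ∘ trans (sym-d a b′))
    in D , _ , stepPos Sa Sb′ ab′>0 loop

  rootLoop-step : ∀ t {S : Fin n → Bool} {a₀ a b} (d : Bigraph n) → unvisited S ≤ suc t →
                  S a₀ ≡ true → S a ≡ true → S b ≡ false →
                  Symmetric d → Connected d → d b a ≢ 0ℤ → ∃₂ (RootLoop (extend S b) (inflP b a d))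
  rootLoop-step t {S} {a = a} {b} d fuel Sa₀ Sa Sb sym-d conn ba≢0 =
    rootLoop-exists t (inflP b a d) (≤-pred (≤-trans (unvisited-extend {S = S} Sb) fuel))
      (extend-⊇ {S = S} Sa₀)
      (inflP-sym b≢a d sym-d) (inflP-connected b≢a d sym-d ba≢0 conn)
    where
    b≢a : _ ≢ _
    b≢a refl = not-¬ Sb Sa

cost-step : ∀ {x c K u′ u} → x ≤ K → c ≤ u′ * K → u′ < u → x + c ≤ u * K
cost-step {K = K} x≤K c≤u′K u′<u = ≤-trans (+-mono-≤ x≤K c≤u′K) (*-monoˡ-≤ K u′<u)

rootLoop-cost : ∀ {S : Fin n → Bool} {d D c} → RootLoop S d D c →
                c ≤ unvisited S * (n * n + n + 3 * n)
rootLoop-cost         (done _)             = z≤n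
rootLoop-cost {S = S} (stepNeg _ Sb _ loop) =
  cost-step ≤-refl (rootLoop-cost loop) (unvisited-extend {S = S} Sb)
rootLoop-cost {n} {S} (stepPos _ Sb _ loop) =
  cost-step (+-monoˡ-≤ (3 * n) (m≤m+n (n * n) n)) (rootLoop-cost loop)
            (unvisited-extend {S = S} Sb)

module Bounds (N : ℕ) where

  infix 4 _≤_·N^_

  record _≤_·N^_ (x a p : ℕ) : Set where
    constructor bounded
    field unbounded : x ≤ a * N ^ p

  open _≤_·N^_ public

  ≤-bounded : ∀ {x y a p} → x ≤ y → y ≤ a ·N^ p → x ≤ a ·N^ p
  ≤-bounded x≤y (bounded y≤) = bounded (≤-trans x≤y y≤)

  bounded-+ : ∀ {x y a b p} → x ≤ a ·N^ p → y ≤ b ·N^ p → x + y ≤ a + b ·N^ p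
  bounded-+ {a = a} {b} {p} (bounded x≤) (bounded y≤) =
    bounded (≤-trans (+-mono-≤ x≤ y≤) (≤-reflexive (sym (*-distribʳ-+ (N ^ p) a b))))

  bounded-* : ∀ {x y a b p q} → x ≤ a ·N^ p → y ≤ b ·N^ q → x * y ≤ a * b ·N^ p + q
  bounded-* {x} {y} {a} {b} {p} {q} (bounded x≤) (bounded y≤) = bounded (begin
    x * y                       ≤⟨ *-mono-≤ x≤ y≤ ⟩
    (a * N ^ p) * (b * N ^ q)   ≡⟨ [m*n]*[o*p]≡[m*o]*[n*p] a (N ^ p) b (N ^ q) ⟩
    (a * b) * (N ^ p * N ^ q)   ≡⟨ cong ((a * b) *_) (^-distribˡ-+-* N p q) ⟨
    (a * b) * N ^ (p + q)       ∎)
    where open ≤-Reasoning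

  bounded-raise : ∀ {x a p q} .{{_ : NonZero N}} → p ≤ q → x ≤ a ·N^ p → x ≤ a ·N^ q
  bounded-raise {a = a} p≤q (bounded x≤) =
    bounded (≤-trans x≤ (*-monoʳ-≤ a (^-monoʳ-≤ N p≤q)))

  const-bounded : ∀ k → k ≤ k ·N^ 0
  const-bounded k = bounded (≤-reflexive (sym (*-identityʳ k)))

  id-bounded : N ≤ 1 ·N^ 1
  id-bounded = bounded (≤-reflexive (sym (trans (*-identityˡ (N ^ 1)) (*-identityʳ N))))

μ≤ : ∀ n → μ n ≤ 112 + n * n
μ≤ 0 = z≤n
μ≤ 1 = z≤n
μ≤ 2 = ≤ᵇ⇒≤ _ _ tt
μ≤ 3 = ≤ᵇ⇒≤ _ _ tt
μ≤ 4 = ≤ᵇ⇒≤ _ _ tt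
μ≤ 5 = ≤ᵇ⇒≤ _ _ tt
μ≤ 6 = ≤ᵇ⇒≤ _ _ tt
μ≤ 7 = ≤ᵇ⇒≤ _ _ tt
μ≤ 8 = ≤ᵇ⇒≤ _ _ tt
μ≤ n@(suc (suc (suc (suc (suc (suc (suc (suc (suc _))))))))) =
  ≤-trans (m∸n≤m (n * n) (2 * n)) (m≤n+m (n * n) 112)

μ'≤ : ∀ n → μ' n ≤ 21 + n
μ'≤ 0 = z≤n
μ'≤ 1 = z≤n
μ'≤ 2 = z≤n
μ'≤ 3 = z≤n
μ'≤ 4 = ≤ᵇ⇒≤ _ _ tt
μ'≤ 5 = ≤ᵇ⇒≤ _ _ tt
μ'≤ 6 = ≤ᵇ⇒≤ _ _ tt
μ'≤ 7 = ≤ᵇ⇒≤ _ _ tt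
μ'≤ 8 = ≤ᵇ⇒≤ _ _ tt
μ'≤ n@(suc (suc (suc (suc (suc (suc (suc (suc (suc _))))))))) =
  ≤-trans (m∸n≤m n 3) (m≤n+m n 21)

module _ {m : ℕ} where

  open Bounds (suc m)

  square-bounded : suc m * suc m ≤ 1 ·N^ 2
  square-bounded = bounded-* id-bounded id-bounded

  pairStep-bounded : suc m * suc m + 3 * suc m ≤ 4 ·N^ 2
  pairStep-bounded =
    bounded-+ square-bounded (bounded-raise (≤ᵇ⇒≤ 1 2 tt) (bounded-* (const-bounded 3) id-bounded))

  rootStep-bounded : suc m * suc m + suc m + 3 * suc m ≤ 5 ·N^ 2
  rootStep-bounded =
    bounded-+ (bounded-+ square-bounded (bounded-raise (≤ᵇ⇒≤ 1 2 tt) id-bounded))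
              (bounded-raise (≤ᵇ⇒≤ 1 2 tt) (bounded-* (const-bounded 3) id-bounded))

  suc-μ-bounded : suc (μ (suc m)) ≤ 114 ·N^ 2
  suc-μ-bounded =
    ≤-bounded (s≤s (μ≤ (suc m))) (bounded-+ (bounded-raise z≤n (const-bounded 113)) square-bounded)

  suc-μ'-bounded : suc (μ' (suc m)) ≤ 23 ·N^ 1
  suc-μ'-bounded =
    ≤-bounded (s≤s (μ'≤ (suc m))) (bounded-+ (bounded-raise z≤n (const-bounded 22)) id-bounded)

  runInfl-cost : ∀ {s} {Δ D : Bigraph (suc m)} {k} → RunInfl s Δ D k → k ≤ 458 * suc m ^ 4
  runInfl-cost (run {c = c} loop) = unbounded (bounded-+ (bounded-+ square⁴ loop-bounded) square⁴)
    where
    square⁴ : suc m * suc m ≤ 1 ·N^ 4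
    square⁴ = bounded-raise (≤ᵇ⇒≤ 2 4 tt) square-bounded
    loop-bounded : c ≤ 456 ·N^ 4
    loop-bounded = ≤-bounded (pairLoop-cost loop) (bounded-* suc-μ-bounded pairStep-bounded)

  runRoot-cost : ∀ {s} {Δ D : Bigraph (suc m)} {k} → RunRoot s Δ D k → k ≤ 99 * suc m ^ 3
  runRoot-cost (run {c₁ = c₁} {c₂} root pairs) =
    unbounded (bounded-+ (bounded-+ (bounded-+ square³ root-bounded) pairs-bounded) square³)
    where
    square³ : suc m * suc m ≤ 1 ·N^ 3
    square³ = bounded-raise (≤ᵇ⇒≤ 2 3 tt) square-bounded
    root-bounded : c₁ ≤ 5 ·N^ 3
    root-bounded = ≤-bounded (rootLoop-cost root)
                     (bounded-* (≤-bounded (unvisited≤n initS) id-bounded) rootStep-bounded)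
    pairs-bounded : c₂ ≤ 92 ·N^ 3
    pairs-bounded = ≤-bounded (pairLoop-cost pairs) (bounded-* suc-μ'-bounded pairStep-bounded)

runInfl-exists : ∀ s (Δ : Bigraph n) → ∃₂ (RunInfl s Δ)
runInfl-exists {n} s Δ = let D , _ , loop = pairLoop-exists s (μ n) Δ in D , _ , run loop

runRoot-exists : ∀ s (Δ : Bigraph (suc n)) → Symmetric Δ → Connected Δ → ∃₂ (RunRoot s Δ)
runRoot-exists {n} s Δ sym-Δ conn =
  let Δ̂ , _ , root  = rootLoop-exists (suc n) {initS} {zero} Δ (unvisited≤n initS)
                          (==-refl (zero {n})) sym-Δ conn
      D , _ , pairs = pairLoop-exists s (μ' (suc n)) Δ̂
  in D , _ , run root pairs

-- Only the symmetry of Δ(A) is used: the cost does not depend on the entries of A.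
theorem5p5 : {c ℓ : Level} (R : CommutativeRing c ℓ) →
    ∃[ C ] ((m : ℕ) (A : Fin (suc m) → Fin (suc m) → CommutativeRing.Carrier R)
      (Δ : Bigraph (suc m)) → Unidiagonal R A → IsDelta R A Δ → Connected Δ →
      (s : Fin 4) →
        ((∃[ D ] ∃[ k ] RunInfl s Δ D k) ×
         (∀ D k → RunInfl s Δ D k → k ≤ C * suc m ^ 4)) ×
        ((∃[ D ] ∃[ k ] RunRoot s Δ D k) ×
         (∀ D k → RunRoot s Δ D k → k ≤ C * suc m ^ 3)))
theorem5p5 R = 458 , λ m A Δ _ Δ-of-A connected s →
  (runInfl-exists s Δ , λ _ _ → runInfl-cost) ,
  (runRoot-exists s Δ (proj₁ Δ-of-A) connected ,
   λ _ _ test → ≤-trans (runRoot-cost test) (*-monoˡ-≤ (suc m ^ 3) (≤ᵇ⇒≤ 99 458 tt)))
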